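{- Let $a,b$ be coprime positive integers, $t=a/b$, let $\alpha$ be an integer with $\alpha\equiv a^2 \pmod{b^2}$ and $|\alpha|\le b^2/2$, and put $x_0=(a^2-\alpha)/b^2$ (an integer). Let $i$ be an integer with $x_0+i\ge 0$, and set $y=\lfloor (x_0+i)^{3/2}+1/2\rfloor$ and $k(x_0+i)=(x_0+i)^3-y^2$. Then there exists a number $C$ (with $2C\in\mathbb{Z}$) satisfying $$2a^3+3(b^2i-\alpha)a+2C\equiv 0 \pmod{2b^3}$$ such that $$k(x_0+i)=\frac{ -2Ca^3+\frac34(b^2i-\alpha)^2a^2-3(b^2i-\alpha)Ca-C^2+(b^2i-\alpha)^3}{b^6},$$ and moreover $|k(x_0+i)|\le (x_0+i)^{3/2}+\frac14$.
   Context: For real $x\ge 0$, $k(x)=x^3-\lfloor x^{3/2}+1/2\rfloor^2$, i.e. $x^3-y^2$ where $y$ is the integer nearest to $x^{3/2}$. Congruences between rationals with denominator dividing 2 are understood as divisibility of the (integer) difference by the modulus. -}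

module Defs where

open import Data.Nat as ℕ using (ℕ; _∸_)
open import Data.Integer as ℤ using (ℤ; +_; _-_)
open import Data.Sum using (_⊎_)
open import Data.Product using (_×_)
open import Relation.Binary.PropositionalEquality using (_≡_)

-- y is the integer nearest to x^(3/2) (ties rounded up), i.e.
-- y = ⌊ x^(3/2) + 1/2 ⌋, characterised for natural x by
--   y - 1/2 ≤ x^(3/2) < y + 1/2 :
-- lower bound is vacuous for y = 0, and for y ≥ 1 both sides are
-- nonnegative, so it is (2y-1)^2 ≤ 4x^3; upper bound is 4x^3 < (2y+1)^2.
IsNearestRoot : ℕ → ℕ → Set
IsNearestRoot x y =
  ((y ≡ 0) ⊎ (((2 ℕ.* y) ∸ 1) ℕ.^ 2 ℕ.≤ 4 ℕ.* x ℕ.^ 3))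
  × (4 ℕ.* x ℕ.^ 3 ℕ.< (2 ℕ.* y ℕ.+ 1) ℕ.^ 2)

kval : ℕ → ℕ → ℤ
kval x y = + (x ℕ.^ 3) - + (y ℕ.^ 2)

{-# OPTIONS --safe #-}
module Submission where

-- With x = x₀ + i and u = b² i − α we have x b² = a² + u.  The statement's D is
-- 2C; taking D = 2 b³ y − 2 a³ − 3 u a gives the congruence, and then
-- 4 b⁶ (x³ − y²) = 4 (a² + u)³ − (2 a³ + 3 u a + D)² expands to the formula.
-- The bound holds for the integer y nearest to √N, for any N: if N = y² + k then
-- k ≤ y, and if y² = N + k then k < y; either way (4k − 1)² ≤ 16 N.

module NearestSquare where
  open import Data.Nat.Base
  open import Data.Nat.Properties
  open import Data.Nat.Solver using (module +-*-Solver)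
  open import Data.Product using (_×_; _,_)
  open import Data.Sum using (_⊎_; inj₁; inj₂)
  open import Relation.Binary.PropositionalEquality
  open +-*-Solver using (solve; _:+_; _:*_; _:^_; _:=_; con)
  open ≤-Reasoning

  IsNearestSqrt : ℕ → ℕ → Set
  IsNearestSqrt N y = ((y ≡ 0) ⊎ ((2 * y ∸ 1) ^ 2 ≤ 4 * N)) × (4 * N < (2 * y + 1) ^ 2)

  [4n]²≡16n² : ∀ n → (4 * n) ^ 2 ≡ 16 * n ^ 2
  [4n]²≡16n² = solve 1 (λ n → (con 4 :* n) :^ 2 := con 16 :* n :^ 2) refl

  [n∸1]²+4n≤[1+n]² : ∀ n → (n ∸ 1) ^ 2 + 4 * n ≤ (1 + n) ^ 2
  [n∸1]²+4n≤[1+n]² zero    = z≤n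
  [n∸1]²+4n≤[1+n]² (suc n) = ≤-reflexive
    (solve 1 (λ n → n :^ 2 :+ con 4 :* (con 1 :+ n) := (con 2 :+ n) :^ 2) refl n)

  excess≤root : ∀ {N y k} → N ≡ y ^ 2 + k → 4 * N < (2 * y + 1) ^ 2 → k ≤ y
  excess≤root {y = y} {k} refl upper =
    *-cancelˡ-≤ 4 (s≤s⁻¹ (+-cancelˡ-≤ (4 * y ^ 2) _ _ (begin
      4 * y ^ 2 + suc (4 * k)   ≡⟨ +-suc (4 * y ^ 2) (4 * k) ⟩
      suc (4 * y ^ 2 + 4 * k)   ≡⟨ cong suc (*-distribˡ-+ 4 (y ^ 2) k) ⟨
      suc (4 * (y ^ 2 + k))     ≤⟨ upper ⟩
      (2 * y + 1) ^ 2           ≡⟨ square-expansion y ⟩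
      4 * y ^ 2 + suc (4 * y)   ∎)))
    where
    square-expansion : ∀ y → (2 * y + 1) ^ 2 ≡ 4 * y ^ 2 + suc (4 * y)
    square-expansion = solve 1 (λ y →
      (con 2 :* y :+ con 1) :^ 2 := con 4 :* y :^ 2 :+ (con 1 :+ con 4 :* y)) refl

  deficit<root : ∀ {N y k} → suc y ^ 2 ≡ N + k → (2 * suc y ∸ 1) ^ 2 ≤ 4 * N → k < suc y
  deficit<root {N} {y} {k} eq lower =
    *-cancelˡ-< 4 k (suc y) (+-cancelˡ-< (4 * N) _ _ (begin-strict
      4 * N + 4 * k                  ≡⟨ *-distribˡ-+ 4 N k ⟨
      4 * (N + k)                    ≡⟨ cong (4 *_) eq ⟨
      4 * suc y ^ 2                  ≡⟨ square-expansion y ⟩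
      suc (2 * y) ^ 2 + (3 + 4 * y)  ≡⟨ cong (λ m → (m ∸ 1) ^ 2 + (3 + 4 * y)) (*-suc 2 y) ⟨
      (2 * suc y ∸ 1) ^ 2 + (3 + 4 * y) ≤⟨ +-monoˡ-≤ (3 + 4 * y) lower ⟩
      4 * N + (3 + 4 * y)            <⟨ +-monoʳ-< (4 * N) (≤-reflexive (sym (*-suc 4 y))) ⟩
      4 * N + 4 * suc y              ∎))
    where
    square-expansion : ∀ y → 4 * suc y ^ 2 ≡ suc (2 * y) ^ 2 + (3 + 4 * y)
    square-expansion = solve 1 (λ y →
      con 4 :* (con 1 :+ y) :^ 2 := (con 1 :+ con 2 :* y) :^ 2 :+ (con 3 :+ con 4 :* y)) refl

  excess-bound : ∀ {N y k} → N ≡ y ^ 2 + k → k ≤ y → (4 * k ∸ 1) ^ 2 ≤ 16 * N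
  excess-bound {y = y} {k} refl k≤y = begin
    (4 * k ∸ 1) ^ 2  ≤⟨ ^-monoˡ-≤ 2 (m∸n≤m (4 * k) 1) ⟩
    (4 * k) ^ 2      ≤⟨ ^-monoˡ-≤ 2 (*-monoʳ-≤ 4 k≤y) ⟩
    (4 * y) ^ 2      ≡⟨ [4n]²≡16n² y ⟩
    16 * y ^ 2       ≤⟨ *-monoʳ-≤ 16 (m≤m+n (y ^ 2) k) ⟩
    16 * (y ^ 2 + k) ∎

  deficit-bound : ∀ {N y k} → y ^ 2 ≡ N + k → k < y → (4 * k ∸ 1) ^ 2 ≤ 16 * N
  deficit-bound {N} {y} {k} eq k<y = +-cancelʳ-≤ (16 * k) _ _ (begin
    (4 * k ∸ 1) ^ 2 + 16 * k       ≡⟨ cong ((4 * k ∸ 1) ^ 2 +_) (*-assoc 4 4 k) ⟩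
    (4 * k ∸ 1) ^ 2 + 4 * (4 * k)  ≤⟨ [n∸1]²+4n≤[1+n]² (4 * k) ⟩
    (1 + 4 * k) ^ 2                ≤⟨ ^-monoˡ-≤ 2 (*-monoʳ-< 4 k<y) ⟩
    (4 * y) ^ 2                    ≡⟨ [4n]²≡16n² y ⟩
    16 * y ^ 2                     ≡⟨ cong (16 *_) eq ⟩
    16 * (N + k)                   ≡⟨ *-distribˡ-+ 16 N k ⟩
    16 * N + 16 * k                ∎)

  nearestSqrt-distance : ∀ {N y} → IsNearestSqrt N y → (4 * ∣ N - y ^ 2 ∣ ∸ 1) ^ 2 ≤ 16 * N
  nearestSqrt-distance {zero}  {zero}  _           = z≤n
  nearestSqrt-distance {suc _} {zero}  (_ , s≤s ())
  nearestSqrt-distance {N}     {suc y} (inj₂ lower , upper) with ≤-total (suc y ^ 2) N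
  ... | inj₁ y²≤N rewrite m≤n⇒∣n-m∣≡n∸m y²≤N =
    excess-bound {N} {suc y} {k} N≡y²+k (excess≤root N≡y²+k upper)
    where
    k : ℕ
    k = N ∸ suc y ^ 2
    N≡y²+k : N ≡ suc y ^ 2 + k
    N≡y²+k = sym (m+[n∸m]≡n y²≤N)
  ... | inj₂ N≤y² rewrite m≤n⇒∣m-n∣≡n∸m N≤y² =
    deficit-bound {N} {suc y} {k} y²≡N+k (deficit<root y²≡N+k lower)
    where
    k : ℕ
    k = suc y ^ 2 ∸ N
    y²≡N+k : suc y ^ 2 ≡ N + k
    y²≡N+k = sym (m+[n∸m]≡n N≤y²)

open import Defs
open import Data.Nat as ℕ using (ℕ; _∸_)
open import Data.Nat.Coprimality using (Coprime)
open import Data.Integer as ℤ using (ℤ; +_; -_; _+_; _-_; _*_; _^_; ∣_∣)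
open import Data.Integer.Divisibility using (_∣_)
open import Data.Product using (Σ; _×_)
open import Relation.Binary.PropositionalEquality using (_≡_)

open import Data.Integer using (_⊖_)
open import Data.Integer.Properties using (pos-*; m-n≡m⊖n; ∣m⊖n∣≡∣n⊖m∣; ∣⊖∣-≤; 0≤i⇒+∣i∣≡i)
open import Data.Integer.Solver using (module +-*-Solver)
open import Data.Nat.Divisibility using (m∣m*n)
open import Data.Nat.Properties using (≤-total; m≤n⇒∣m-n∣≡n∸m; m≤n⇒∣n-m∣≡n∸m)
open import Data.Product using (_,_)
open import Data.Sum using (inj₁; inj₂)
open import Relation.Binary.PropositionalEquality using (refl; sym; trans; cong; cong₂; subst; subst₂; module ≡-Reasoning)
open +-*-Solver using (solve; _:+_; _:-_; :-_; _:*_; _:^_; _:=_; con)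
open NearestSquare using (nearestSqrt-distance)

pos-^ : ∀ (m n : ℕ) → + (m ℕ.^ n) ≡ (+ m) ^ n
pos-^ m ℕ.zero    = refl
pos-^ m (ℕ.suc n) = trans (pos-* m (m ℕ.^ n)) (cong (+ m *_) (pos-^ m n))

∣m⊖n∣≡∣m-n∣ : ∀ m n → ∣ m ⊖ n ∣ ≡ ℕ.∣ m - n ∣
∣m⊖n∣≡∣m-n∣ m n with ≤-total m n
... | inj₁ m≤n = trans (∣⊖∣-≤ m≤n) (sym (m≤n⇒∣m-n∣≡n∸m m≤n))
... | inj₂ n≤m = trans (∣m⊖n∣≡∣n⊖m∣ m n) (trans (∣⊖∣-≤ n≤m) (sym (m≤n⇒∣n-m∣≡n∸m n≤m)))

kval-bound : ∀ {x y} → IsNearestRoot x y → (4 ℕ.* ∣ kval x y ∣ ∸ 1) ℕ.^ 2 ℕ.≤ 16 ℕ.* x ℕ.^ 3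
kval-bound {x} {y} nearest = subst (λ d → (4 ℕ.* d ∸ 1) ℕ.^ 2 ℕ.≤ 16 ℕ.* x ℕ.^ 3)
  (sym (trans (cong ∣_∣ (m-n≡m⊖n (x ℕ.^ 3) (y ℕ.^ 2))) (∣m⊖n∣≡∣m-n∣ (x ℕ.^ 3) (y ℕ.^ 2))))
  (nearestSqrt-distance {x ℕ.^ 3} nearest)

x*c≡d-α⇒[x+i]*c≡d+[c*i-α] : ∀ x i c d α → x * c ≡ d - α → (x + i) * c ≡ d + (c * i - α)
x*c≡d-α⇒[x+i]*c≡d+[c*i-α] x i c d α eq = begin
  (x + i) * c       ≡⟨ solve 3 (λ x i c → (x :+ i) :* c := x :* c :+ c :* i) refl x i c ⟩
  x * c + c * i     ≡⟨ cong (_+ c * i) eq ⟩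
  d - α + c * i     ≡⟨ solve 3 (λ d α t → d :- α :+ t := d :+ (t :- α)) refl d α (c * i) ⟩
  d + (c * i - α)   ∎
  where open ≡-Reasoning

cube-identity : ∀ a u D →
  + 4 * (a ^ 2 + u) ^ 3 - (+ 2 * a ^ 3 + + 3 * u * a + D) ^ 2
    ≡ - (+ 4 * D * a ^ 3) + + 3 * u ^ 2 * a ^ 2 - + 6 * u * D * a - D ^ 2 + + 4 * u ^ 3
cube-identity = solve 3 (λ a u D →
  con (+ 4) :* (a :^ 2 :+ u) :^ 3 :- (con (+ 2) :* a :^ 3 :+ con (+ 3) :* u :* a :+ D) :^ 2
    := :- (con (+ 4) :* D :* a :^ 3) :+ con (+ 3) :* u :^ 2 :* a :^ 2
       :- con (+ 6) :* u :* D :* a :- D :^ 2 :+ con (+ 4) :* u :^ 3) refl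

scaled-cube-identity : ∀ a b u x y D →
  x * b ^ 2 ≡ a ^ 2 + u → + 2 * b ^ 3 * y ≡ + 2 * a ^ 3 + + 3 * u * a + D →
  + 4 * b ^ 6 * (x ^ 3 - y ^ 2)
    ≡ - (+ 4 * D * a ^ 3) + + 3 * u ^ 2 * a ^ 2 - + 6 * u * D * a - D ^ 2 + + 4 * u ^ 3
scaled-cube-identity a b u x y D xb²≡a²+u 2b³y≡ = begin
  + 4 * b ^ 6 * (x ^ 3 - y ^ 2)
    ≡⟨ solve 3 (λ b x y → con (+ 4) :* b :^ 6 :* (x :^ 3 :- y :^ 2)
                       := con (+ 4) :* (x :* b :^ 2) :^ 3 :- (con (+ 2) :* b :^ 3 :* y) :^ 2) refl b x y ⟩
  + 4 * (x * b ^ 2) ^ 3 - (+ 2 * b ^ 3 * y) ^ 2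
    ≡⟨ cong₂ (λ p q → + 4 * p ^ 3 - q ^ 2) xb²≡a²+u 2b³y≡ ⟩
  + 4 * (a ^ 2 + u) ^ 3 - (+ 2 * a ^ 3 + + 3 * u * a + D) ^ 2
    ≡⟨ cube-identity a u D ⟩
  - (+ 4 * D * a ^ 3) + + 3 * u ^ 2 * a ^ 2 - + 6 * u * D * a - D ^ 2 + + 4 * u ^ 3 ∎
  where open ≡-Reasoning

kval-formula : ∀ (a b x y : ℕ) u D →
  + x * + (b ℕ.^ 2) ≡ + (a ℕ.^ 2) + u →
  + (2 ℕ.* b ℕ.^ 3 ℕ.* y) ≡ + 2 * (+ a) ^ 3 + + 3 * u * + a + D →
  + 4 * + (b ℕ.^ 6) * kval x y
    ≡ - (+ 4 * D * (+ a) ^ 3) + + 3 * u ^ 2 * (+ a) ^ 2 - + 6 * u * D * + a - D ^ 2 + + 4 * u ^ 3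
kval-formula a b x y u D xb²≡a²+u 2b³y≡ = begin
  + 4 * + (b ℕ.^ 6) * kval x y
    ≡⟨ cong₂ (λ p k → + 4 * p * k) (pos-^ b 6) (cong₂ _-_ (pos-^ x 3) (pos-^ y 2)) ⟩
  + 4 * (+ b) ^ 6 * ((+ x) ^ 3 - (+ y) ^ 2)
    ≡⟨ scaled-cube-identity (+ a) (+ b) u (+ x) (+ y) D
         (subst₂ (λ p q → + x * p ≡ q + u) (pos-^ b 2) (pos-^ a 2) xb²≡a²+u)
         (trans (sym pos-2b³y) 2b³y≡) ⟩
  - (+ 4 * D * (+ a) ^ 3) + + 3 * u ^ 2 * (+ a) ^ 2 - + 6 * u * D * + a - D ^ 2 + + 4 * u ^ 3 ∎
  where
  open ≡-Reasoning
  pos-2b³y : + (2 ℕ.* b ℕ.^ 3 ℕ.* y) ≡ + 2 * (+ b) ^ 3 * + y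
  pos-2b³y = trans (pos-* (2 ℕ.* b ℕ.^ 3) y)
               (cong (_* + y) (trans (pos-* 2 (b ℕ.^ 3)) (cong (+ 2 *_) (pos-^ b 3))))

-- Positivity, coprimality and the conditions on α only make x₀ the paper's
-- integer; the conclusion holds for every x₀ with x₀ b² = a² − α.
lemma2p1 : (a b : ℕ) → 0 ℕ.< a → 0 ℕ.< b → Coprime a b →
    (α : ℤ) → (+ (b ℕ.^ 2)) ∣ (+ (a ℕ.^ 2) - α) → 2 ℕ.* ∣ α ∣ ℕ.≤ b ℕ.^ 2 →
    (x₀ : ℤ) → x₀ * + (b ℕ.^ 2) ≡ + (a ℕ.^ 2) - α →
    (i : ℤ) → + 0 ℤ.≤ x₀ + i →
    (y : ℕ) → IsNearestRoot (∣ x₀ + i ∣) y →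
    Σ ℤ (λ D →
      ((+ (2 ℕ.* b ℕ.^ 3)) ∣ (+ 2 * (+ a) ^ 3 + + 3 * (+ (b ℕ.^ 2) * i - α) * + a + D))
      × (+ 4 * + (b ℕ.^ 6) * kval (∣ x₀ + i ∣) y
          ≡ - (+ 4 * D * (+ a) ^ 3) + + 3 * (+ (b ℕ.^ 2) * i - α) ^ 2 * (+ a) ^ 2
            - + 6 * (+ (b ℕ.^ 2) * i - α) * D * + a - D ^ 2
            + + 4 * (+ (b ℕ.^ 2) * i - α) ^ 3)
      × (((4 ℕ.* ∣ (kval (∣ x₀ + i ∣) y) ∣) ∸ 1) ℕ.^ 2 ℕ.≤ 16 ℕ.* (∣ x₀ + i ∣ ℕ.^ 3)))
lemma2p1 a b _ _ _ α _ _ x₀ x₀b²≡a²-α i 0≤x y nearest =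
  D , 2b³∣s+D , kval-formula a b n y u D nb²≡a²+u (sym s+D≡2b³y) , kval-bound {n} nearest
  where
  u s 2b³y D : ℤ
  u = + (b ℕ.^ 2) * i - α
  s = + 2 * (+ a) ^ 3 + + 3 * u * + a
  2b³y = + (2 ℕ.* b ℕ.^ 3 ℕ.* y)
  D = 2b³y - s

  n : ℕ
  n = ∣ x₀ + i ∣

  s+D≡2b³y : s + D ≡ 2b³y
  s+D≡2b³y = solve 2 (λ s t → s :+ (t :- s) := t) refl s 2b³y

  2b³∣s+D : + (2 ℕ.* b ℕ.^ 3) ∣ s + D
  2b³∣s+D = subst (+ (2 ℕ.* b ℕ.^ 3) ∣_) (sym s+D≡2b³y) (m∣m*n y)

  nb²≡a²+u : + n * + (b ℕ.^ 2) ≡ + (a ℕ.^ 2) + u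
  nb²≡a²+u = subst (λ x → x * + (b ℕ.^ 2) ≡ + (a ℕ.^ 2) + u) (sym (0≤i⇒+∣i∣≡i 0≤x))
    (x*c≡d-α⇒[x+i]*c≡d+[c*i-α] x₀ i (+ (b ℕ.^ 2)) (+ (a ℕ.^ 2)) α x₀b²≡a²-α)
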